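{- Let $n\ge 2$ and $c\ge 1$ be integers with $n\ge 2c$, and let $\Gamma=(V,H)$ be the oriented hypergraph with $V=\{1,\dots,n\}$ and $H=\{(h_{in},h_{out}): h_{in},h_{out}\subseteq V,\ \#h_{in}=\#h_{out}=c,\ h_{in}\cap h_{out}=\emptyset\}$. Then the eigenvalues $\lambda_1\le\dots\le\lambda_n$ of its normalized Laplacian satisfy $\lambda_1=0$ and $\lambda_2=\dots=\lambda_n=n/(n-1)$.
   Context: An oriented hypergraph is a pair $\Gamma=(V,H)$, $V$ finite, each hyperedge $h\in H$ a pair $(h_{in},h_{out})$ of disjoint subsets of $V$; $h$ is identified with $h_{in}\cup h_{out}$. $\deg(i)$ is the number of hyperedges containing $i$. The normalized Laplacian acts on $f:V\to\mathbb{R}$ by $$Lf(i)=\frac{1}{\deg(i)}\Big[\sum_{h:\,i\in h_{in}}\Big(\sum_{i'\in h_{in}}f(i')-\sum_{j'\in h_{out}}f(j')\Big)-\sum_{h:\,i\in h_{out}}\Big(\sum_{i'\in h_{in}}f(i')-\sum_{j'\in h_{out}}f(j')\Big)\Big],$$ with real eigenvalues listed with multiplicity as $\lambda_1\le\dots\le\lambda_n$. -}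

module Defs where

open import Data.Bool using (Bool; true; false; _∧_; if_then_else_)
open import Data.Nat as ℕ using (ℕ; zero; suc; _≡ᵇ_; _∸_)
open import Data.Integer as ℤ using (+_)
open import Data.Fin using (Fin; zero; suc; punchIn; toℕ; _≟_)
open import Data.Fin.Subset using (Subset; inside; outside; ∣_∣; _∩_)
open import Data.Vec using (Vec; []; _∷_; lookup)
open import Data.List as List using (List; []; _∷_; [_]; _++_; filter; map; foldr; length)
open import Data.Product using (_×_; _,_; proj₁; proj₂)
open import Relation.Nullary.Decidable using (does)
open import Relation.Binary.PropositionalEquality using (_≡_)
open import Data.Rational as ℚ using (ℚ; 0ℚ; 1ℚ; _+_; _*_; _-_; -_)

-- A hyperedge on vertex set Fin n: a pair (h_in , h_out) of subsets.
-- (Disjointness is imposed where hyperedge sets are formed.)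
Hyperedge : ℕ → Set
Hyperedge n = Subset n × Subset n

h-in h-out : ∀ {n} → Hyperedge n → Subset n
h-in = proj₁
h-out = proj₂

_∈ᵇ_ : ∀ {n} → Fin n → Subset n → Bool
i ∈ᵇ s = lookup s i

-- An oriented hypergraph on vertex set Fin n: a finite list of hyperedges
-- (the hyperedge set H, listed without repetition).
OrientedHypergraph : ℕ → Set
OrientedHypergraph n = List (Hyperedge n)

sumℚ : List ℚ → ℚ
sumℚ = foldr _+_ 0ℚ

Σ[_] : ∀ n → (Fin n → ℚ) → ℚ
Σ[ zero ] f = 0ℚ
Σ[ suc n ] f = f zero + Σ[ n ] (λ i → f (suc i))

ℕ→ℚ : ℕ → ℚ
ℕ→ℚ k = (+ k) ℚ./ 1

-- total division a / b on naturals into ℚ (b = 0 gives 0; never used with b = 0 below)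
frac : ℕ → ℕ → ℚ
frac a zero = 0ℚ
frac a (suc b) = (+ a) ℚ./ suc b

deg : ∀ {n} → OrientedHypergraph n → Fin n → ℕ
deg H i = length (filter (λ h → Data.Bool._≟_ (Data.Bool._∨_ (i ∈ᵇ h-in h) (i ∈ᵇ h-out h)) true) H)
  where import Data.Bool

ind : ∀ {n} → Subset n → Fin n → ℚ
ind s i = if i ∈ᵇ s then 1ℚ else 0ℚ

edgeVal : ∀ {n} → Hyperedge n → (Fin n → ℚ) → ℚ
edgeVal {n} h f = Σ[ n ] (λ k → ind (h-in h) k * f k) - Σ[ n ] (λ k → ind (h-out h) k * f k)

laplacian : ∀ {n} → OrientedHypergraph n → (Fin n → ℚ) → Fin n → ℚ
laplacian H f i =
  frac 1 (deg H i) *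
    (sumℚ (map (λ h → ind (h-in h) i * edgeVal h f) H)
     - sumℚ (map (λ h → ind (h-out h) i * edgeVal h f) H))

basis : ∀ {n} → Fin n → Fin n → ℚ
basis j k = if does (j ≟ k) then 1ℚ else 0ℚ

laplacianMatrix : ∀ {n} → OrientedHypergraph n → Fin n → Fin n → ℚ
laplacianMatrix H i j = laplacian H (basis j) i

sign : ℕ → ℚ
sign zero = 1ℚ
sign (suc zero) = - 1ℚ
sign (suc (suc k)) = sign k

det : ∀ n → (Fin n → Fin n → ℚ) → ℚ
det zero M = 1ℚ
det (suc n) M = Σ[ suc n ] (λ j → sign (toℕ j) * M zero j * det n (λ i k → M (suc i) (punchIn j k)))

charPoly : ∀ n → (Fin n → Fin n → ℚ) → ℚ → ℚ
charPoly n A x = det n (λ i j → x * basis i j - A i j)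

_^_ : ℚ → ℕ → ℚ
x ^ zero = 1ℚ
x ^ suc k = x * (x ^ k)

allSubsets : ∀ n → List (Subset n)
allSubsets zero = [ [] ]
allSubsets (suc n) = map (inside ∷_) (allSubsets n) ++ map (outside ∷_) (allSubsets n)

completeHypergraph : ∀ n → ℕ → OrientedHypergraph n
completeHypergraph n c =
  filter (λ h → Data.Bool._≟_ ((∣ h-in h ∣ ≡ᵇ c) ∧ (∣ h-out h ∣ ≡ᵇ c) ∧ (∣ h-in h ∩ h-out h ∣ ≡ᵇ 0)) true)
    (List.concatMap (λ p → map (λ q → (p , q)) (allSubsets n)) (allSubsets n))
  where import Data.Bool

module Submission where

-- Let t_h = 1_{h_in} − 1_{h_out} be the signed incidence vector of an edge and G i j = Σ_h t_h(i) t_h(j)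
-- its Gram matrix. Then L i j = G i j / deg i, and deg i = G i i because no edge contains a vertex on
-- both sides. Each t_h sums to ∣h_in∣ − ∣h_out∣ = 0, so every row of G sums to zero, while splitting off
-- two coordinates shows that all off-diagonal entries of G are equal. Hence L = n/(n−1)·I − 1/(n−1)·J,
-- and det(αI + βJ) = α^(n−1) (α + nβ) with α = x − n/(n−1), β = 1/(n−1) gives x·α^(n−1).

open import Algebra.Properties.Group using (inverseˡ-unique)
open import Data.Bool as Bool using (Bool; true; false; if_then_else_; _∧_; _∨_)
import Data.Bool.Properties as Boolₚ
open import Data.Fin using (Fin; zero; suc; toℕ; punchIn; punchOut; lift)
import Data.Fin.Properties as Finₚ
open import Data.Fin.Subset using (Subset; ∣_∣; _∩_)
import Data.Integer as ℤ
import Data.Integer.Properties as ℤₚ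
open import Data.List as List using (List; []; _∷_; _++_; filter; map; length; concatMap)
import Data.List.Properties as Listₚ
open import Data.List.Membership.Propositional using (_∈_)
import Data.List.Membership.Propositional.Properties as ∈ₚ
open import Data.List.Relation.Unary.Any using (here; there)
open import Data.Nat as ℕ using (ℕ; zero; suc; _≡ᵇ_; _≤_; z≤n; s≤s; _∸_)
import Data.Nat.Coprimality as Coprimality
import Data.Nat.Properties as ℕₚ
open import Data.Product using (_×_; _,_; ∃)
open import Data.Rational as ℚ using (ℚ; 0ℚ; 1ℚ; ½; _+_; _*_; _-_; -_; mkℚ)
import Data.Rational.Properties as ℚₚ
open import Data.Rational.Solver using (module +-*-Solver)
open import Data.Unit using (⊤; tt)
open import Data.Vec using ([]; _∷_; lookup; insertAt)
import Data.Vec.Properties as Vecₚ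
open import Function.Bundles using (Equivalence)
open import Relation.Binary.PropositionalEquality
open import Relation.Nullary using (yes; no)
open import Relation.Nullary.Decidable using (does)
open import Relation.Unary using (Pred; Decidable)

open import Defs

open +-*-Solver
open ≡-Reasoning

coprimeTo-1 : ∀ k → Coprimality.Coprime k 1
coprimeTo-1 k = Coprimality.sym (Coprimality.1-coprimeTo k)

ℕ→ℚ≡mkℚ : ∀ k → ℕ→ℚ k ≡ mkℚ (ℤ.+ k) 0 (coprimeTo-1 k)
ℕ→ℚ≡mkℚ k = ℚₚ.normalize-coprime (coprimeTo-1 k)

ℕ→ℚ-suc : ∀ m → ℕ→ℚ (suc m) ≡ ℕ→ℚ m + 1ℚ
ℕ→ℚ-suc m = trans (ℚₚ./-cong {q₁ = 1} {q₂ = 1} numerators refl) (cong (_+ 1ℚ) (sym (ℕ→ℚ≡mkℚ m)))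
  where
  numerators : ℤ.+ suc m ≡ (ℤ.+ m) ℤ.* (ℤ.+ 1) ℤ.+ (ℤ.+ 1) ℤ.* (ℤ.+ 1)
  numerators = trans (cong ℤ.+_ (ℕₚ.+-comm 1 m)) (cong₂ ℤ._+_ (sym (ℤₚ.*-identityʳ (ℤ.+ m))) refl)

frac-1*ℕ→ℚ : ∀ d → frac 1 (suc d) * ℕ→ℚ (suc d) ≡ 1ℚ
frac-1*ℕ→ℚ d = trans
  (cong₂ _*_ (ℚₚ.normalize-coprime (Coprimality.1-coprimeTo (suc d))) (ℕ→ℚ≡mkℚ (suc d)))
  (ℚₚ.*-inverseˡ (mkℚ (ℤ.+ suc d) 0 (coprimeTo-1 (suc d))))

frac≡ℕ→ℚ*frac-1 : ∀ k d → frac k (suc d) ≡ ℕ→ℚ k * frac 1 (suc d)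
frac≡ℕ→ℚ*frac-1 k d = trans
  (ℚₚ./-cong {p₂ = (ℤ.+ k) ℤ.* (ℤ.+ 1)} {q₂ = 1 ℕ.* suc d}
    (sym (ℤₚ.*-identityʳ (ℤ.+ k))) (sym (ℕₚ.+-identityʳ (suc d))))
  (sym (cong₂ _*_ (ℕ→ℚ≡mkℚ k) (ℚₚ.normalize-coprime (Coprimality.1-coprimeTo (suc d)))))

x≡-x⇒x≡0 : ∀ x → x ≡ - x → x ≡ 0ℚ
x≡-x⇒x≡0 x x≡-x = begin
  x               ≡⟨ solve 1 (λ a → a := (a :+ a) :* con ½) refl x ⟩
  (x + x) * ½     ≡⟨ cong (λ z → (x + z) * ½) x≡-x ⟩
  (x + - x) * ½   ≡⟨ solve 1 (λ a → (a :- a) :* con ½ := con 0ℚ) refl x ⟩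
  0ℚ              ∎

a+b*e≡0⇒u*e≡-v : ∀ u a v b e → u * a ≡ 1ℚ → v * b ≡ 1ℚ → a + b * e ≡ 0ℚ → u * e ≡ - v
a+b*e≡0⇒u*e≡-v u a v b e ua≡1 vb≡1 a+be≡0 = begin
  u * e                 ≡⟨ solve 2 (λ u e → u :* e := (u :* e) :* con 1ℚ) refl u e ⟩
  (u * e) * 1ℚ          ≡⟨ cong ((u * e) *_) vb≡1 ⟨
  (u * e) * (v * b)     ≡⟨ solve 4 (λ u e v b → (u :* e) :* (v :* b) := (u :* v) :* (b :* e)) refl u e v b ⟩
  (u * v) * (b * e)     ≡⟨ cong ((u * v) *_) be≡-a ⟩
  (u * v) * (- a)       ≡⟨ solve 3 (λ u v a → (u :* v) :* (:- a) := :- (v :* (u :* a))) refl u v a ⟩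
  - (v * (u * a))       ≡⟨ cong (λ z → - (v * z)) ua≡1 ⟩
  - (v * 1ℚ)            ≡⟨ cong -_ (ℚₚ.*-identityʳ v) ⟩
  - v                   ∎
  where
  be≡-a : b * e ≡ - a
  be≡-a = inverseˡ-unique ℚₚ.+-0-group (b * e) a (trans (ℚₚ.+-comm (b * e) a) a+be≡0)

Σ-cong : ∀ n {f g : Fin n → ℚ} → (∀ k → f k ≡ g k) → Σ[ n ] f ≡ Σ[ n ] g
Σ-cong zero    f≗g = refl
Σ-cong (suc n) f≗g = cong₂ _+_ (f≗g zero) (Σ-cong n (λ k → f≗g (suc k)))

Σ-zero : ∀ n → Σ[ n ] (λ _ → 0ℚ) ≡ 0ℚ
Σ-zero zero    = refl
Σ-zero (suc n) = cong (0ℚ +_) (Σ-zero n)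

Σ-distrib-+ : ∀ n (f g : Fin n → ℚ) → Σ[ n ] (λ k → f k + g k) ≡ Σ[ n ] f + Σ[ n ] g
Σ-distrib-+ zero    f g = refl
Σ-distrib-+ (suc n) f g = begin
  (f zero + g zero) + Σ[ n ] (λ k → f (suc k) + g (suc k))
    ≡⟨ cong ((f zero + g zero) +_) (Σ-distrib-+ n (λ k → f (suc k)) (λ k → g (suc k))) ⟩
  (f zero + g zero) + (Σ[ n ] (λ k → f (suc k)) + Σ[ n ] (λ k → g (suc k)))
    ≡⟨ solve 4 (λ a b c d → (a :+ b) :+ (c :+ d) := (a :+ c) :+ (b :+ d)) refl (f zero) (g zero) _ _ ⟩
  _ ∎

Σ-*ˡ : ∀ n (c : ℚ) (f : Fin n → ℚ) → Σ[ n ] (λ k → c * f k) ≡ c * Σ[ n ] f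
Σ-*ˡ zero    c f = sym (ℚₚ.*-zeroʳ c)
Σ-*ˡ (suc n) c f = begin
  c * f zero + Σ[ n ] (λ k → c * f (suc k))  ≡⟨ cong (c * f zero +_) (Σ-*ˡ n c (λ k → f (suc k))) ⟩
  c * f zero + c * Σ[ n ] (λ k → f (suc k))  ≡⟨ ℚₚ.*-distribˡ-+ c _ _ ⟨
  _                                          ∎

Σ-neg : ∀ n (f : Fin n → ℚ) → Σ[ n ] (λ k → - f k) ≡ - Σ[ n ] f
Σ-neg n f = begin
  Σ[ n ] (λ k → - f k)         ≡⟨ Σ-cong n (λ k → solve 1 (λ a → :- a := (:- con 1ℚ) :* a) refl (f k)) ⟩
  Σ[ n ] (λ k → - 1ℚ * f k)    ≡⟨ Σ-*ˡ n (- 1ℚ) f ⟩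
  - 1ℚ * Σ[ n ] f              ≡⟨ solve 1 (λ a → (:- con 1ℚ) :* a := :- a) refl (Σ[ n ] f) ⟩
  - Σ[ n ] f                   ∎

Σ-distrib-- : ∀ n (f g : Fin n → ℚ) → Σ[ n ] (λ k → f k - g k) ≡ Σ[ n ] f - Σ[ n ] g
Σ-distrib-- n f g = trans (Σ-distrib-+ n f (λ k → - g k)) (cong (Σ[ n ] f +_) (Σ-neg n g))

Σ-const : ∀ m b → Σ[ m ] (λ _ → b) ≡ ℕ→ℚ m * b
Σ-const zero    b = sym (ℚₚ.*-zeroˡ b)
Σ-const (suc m) b = begin
  b + Σ[ m ] (λ _ → b)   ≡⟨ cong (b +_) (Σ-const m b) ⟩
  b + ℕ→ℚ m * b          ≡⟨ solve 2 (λ b N → b :+ N :* b := (N :+ con 1ℚ) :* b) refl b (ℕ→ℚ m) ⟩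
  (ℕ→ℚ m + 1ℚ) * b       ≡⟨ cong (_* b) (ℕ→ℚ-suc m) ⟨
  ℕ→ℚ (suc m) * b        ∎

Σ-punchIn : ∀ m (i : Fin (suc m)) (f : Fin (suc m) → ℚ) → Σ[ suc m ] f ≡ f i + Σ[ m ] (λ j → f (punchIn i j))
Σ-punchIn m       zero    f = refl
Σ-punchIn (suc m) (suc i) f = begin
  f zero + Σ[ suc m ] (λ j → f (suc j))
    ≡⟨ cong (f zero +_) (Σ-punchIn m i (λ j → f (suc j))) ⟩
  f zero + (f (suc i) + Σ[ m ] (λ j → f (suc (punchIn i j))))
    ≡⟨ solve 3 (λ a b c → a :+ (b :+ c) := b :+ (a :+ c)) refl (f zero) (f (suc i)) _ ⟩
  _ ∎

Σ-basisˡ : ∀ n (j : Fin n) (g : Fin n → ℚ) → Σ[ n ] (λ k → basis j k * g k) ≡ g j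
Σ-basisˡ (suc n) zero g = begin
  1ℚ * g zero + Σ[ n ] (λ k → 0ℚ * g (suc k))
    ≡⟨ cong₂ _+_ (ℚₚ.*-identityˡ (g zero)) (Σ-cong n (λ k → ℚₚ.*-zeroˡ (g (suc k)))) ⟩
  g zero + Σ[ n ] (λ _ → 0ℚ)   ≡⟨ cong (g zero +_) (Σ-zero n) ⟩
  g zero + 0ℚ                   ≡⟨ ℚₚ.+-identityʳ _ ⟩
  g zero                        ∎
Σ-basisˡ (suc n) (suc j) g = begin
  0ℚ * g zero + Σ[ n ] (λ k → basis j k * g (suc k))
    ≡⟨ cong₂ _+_ (ℚₚ.*-zeroˡ (g zero)) (Σ-basisˡ n j (λ k → g (suc k))) ⟩
  0ℚ + g (suc j)   ≡⟨ ℚₚ.+-identityˡ _ ⟩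
  g (suc j)        ∎

Σ-basisʳ : ∀ n (j : Fin n) (g : Fin n → ℚ) → Σ[ n ] (λ k → g k * basis j k) ≡ g j
Σ-basisʳ n j g = trans (Σ-cong n (λ k → ℚₚ.*-comm (g k) (basis j k))) (Σ-basisˡ n j g)

sign-suc : ∀ k → sign (suc k) ≡ - sign k
sign-suc zero    = refl
sign-suc (suc k) = begin
  sign k             ≡⟨ solve 1 (λ a → a := :- (:- a)) refl (sign k) ⟩
  - (- sign k)       ≡⟨ cong -_ (sign-suc k) ⟨
  - sign (suc k)     ∎

det-cong : ∀ n {A B : Fin n → Fin n → ℚ} → (∀ i j → A i j ≡ B i j) → det n A ≡ det n B
det-cong zero    A≡B = refl
det-cong (suc n) A≡B = Σ-cong (suc n) (λ j →
  cong₂ (λ a d → sign (toℕ j) * a * d) (A≡B zero j) (det-cong n (λ i k → A≡B (suc i) (punchIn j k))))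

infixr 5 _▸_
_▸_ : ∀ {m n} → (Fin n → ℚ) → (Fin m → Fin n → ℚ) → Fin (suc m) → Fin n → ℚ
(u ▸ A) zero    = u
(u ▸ A) (suc i) = A i

-- G j k is the term attached to the ordered pair of distinct indices (j , punchIn j k);
-- SwapSymmetric says that it does not depend on the order of the pair.
SwapSymmetric : ∀ N → (Fin (suc N) → Fin N → ℚ) → Set
SwapSymmetric zero    G = ⊤
SwapSymmetric (suc N) G =
  (∀ k → G zero k ≡ G (suc k) zero) × SwapSymmetric N (λ j k → G (suc j) (suc k))

SwapSymmetric-cong : ∀ N {G H : Fin (suc N) → Fin N → ℚ} →
  (∀ j k → G j k ≡ H j k) → SwapSymmetric N G → SwapSymmetric N H
SwapSymmetric-cong zero    G≡H _             = tt
SwapSymmetric-cong (suc N) G≡H (sym₀ , symₛ) =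
  (λ k → trans (sym (G≡H zero k)) (trans (sym₀ k) (G≡H (suc k) zero))) ,
  SwapSymmetric-cong N (λ j k → G≡H (suc j) (suc k)) symₛ

signedPairSum : ∀ N → (Fin (suc N) → Fin N → ℚ) → ℚ
signedPairSum N G = Σ[ suc N ] (λ j → Σ[ N ] (λ k → sign (toℕ j) * sign (toℕ k) * G j k))

-- The pairs (0 , k+1) and (k+1 , 0) carry opposite signs, so they cancel; the rest is the same sum one size down.
signedPairSum-symmetric : ∀ N G → SwapSymmetric N G → signedPairSum N G ≡ 0ℚ
signedPairSum-symmetric zero    G _             = refl
signedPairSum-symmetric (suc N) G (sym₀ , symₛ) = begin
  Σ[ suc N ] (λ k → 1ℚ * sign (toℕ k) * G zero k)
    + Σ[ suc N ] (λ j → sign (suc (toℕ j)) * 1ℚ * G (suc j) zero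
        + Σ[ N ] (λ k → sign (suc (toℕ j)) * sign (suc (toℕ k)) * G (suc j) (suc k)))
    ≡⟨ cong₂ _+_ (Σ-cong (suc N) (λ k → cong (_* G zero k) (ℚₚ.*-identityˡ (sign (toℕ k)))))
                 (Σ-cong (suc N) (λ j → cong₂ _+_ (firstColumn j) (Σ-cong N (signs j)))) ⟩
  A + Σ[ suc N ] (λ j → - (sign (toℕ j) * G zero j)
        + Σ[ N ] (λ k → sign (toℕ j) * sign (toℕ k) * G (suc j) (suc k)))
    ≡⟨ cong (A +_) (Σ-distrib-+ (suc N) (λ j → - (sign (toℕ j) * G zero j))
                                     (λ j → Σ[ N ] (λ k → sign (toℕ j) * sign (toℕ k) * G (suc j) (suc k)))) ⟩
  A + (Σ[ suc N ] (λ j → - (sign (toℕ j) * G zero j)) + signedPairSum N (λ j k → G (suc j) (suc k)))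
    ≡⟨ cong₂ (λ a b → A + (a + b)) (Σ-neg (suc N) (λ j → sign (toℕ j) * G zero j))
                                   (signedPairSum-symmetric N _ symₛ) ⟩
  A + (- A + 0ℚ)
    ≡⟨ solve 1 (λ a → a :+ (:- a :+ con 0ℚ) := con 0ℚ) refl A ⟩
  0ℚ ∎
  where
  A = Σ[ suc N ] (λ k → sign (toℕ k) * G zero k)
  firstColumn : ∀ j → sign (suc (toℕ j)) * 1ℚ * G (suc j) zero ≡ - (sign (toℕ j) * G zero j)
  firstColumn j rewrite sign-suc (toℕ j) | sym (sym₀ j) =
    solve 2 (λ s g → :- s :* con 1ℚ :* g := :- (s :* g)) refl (sign (toℕ j)) (G zero j)
  signs : ∀ j k → sign (suc (toℕ j)) * sign (suc (toℕ k)) * G (suc j) (suc k)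
                ≡ sign (toℕ j) * sign (toℕ k) * G (suc j) (suc k)
  signs j k rewrite sign-suc (toℕ j) | sign-suc (toℕ k) =
    solve 3 (λ s t g → :- s :* :- t :* g := s :* t :* g) refl (sign (toℕ j)) (sign (toℕ k)) (G (suc j) (suc k))

minorTerms-swapSymmetric : ∀ n (R : Fin (suc (suc n)) → Fin (suc (suc n)) → ℚ)
  (Ψ : (Fin n → Fin (suc (suc n))) → ℚ) →
  (∀ a b → R a b ≡ R b a) → (∀ f g → (∀ x → f x ≡ g x) → Ψ f ≡ Ψ g) →
  SwapSymmetric (suc n) (λ j k → R j (punchIn j k) * Ψ (λ x → punchIn j (punchIn k x)))
minorTerms-swapSymmetric zero R Ψ R-sym Ψ-cong =
  (λ k → cong (_* Ψ (λ x → suc (punchIn k x))) (R-sym zero (suc k))) , tt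
minorTerms-swapSymmetric (suc n) R Ψ R-sym Ψ-cong =
  (λ k → cong (_* Ψ (λ x → suc (punchIn k x))) (R-sym zero (suc k))) ,
  SwapSymmetric-cong (suc n) lifted
    (minorTerms-swapSymmetric n (λ a b → R (suc a) (suc b)) (λ f → Ψ (lift 1 f))
      (λ a b → R-sym (suc a) (suc b))
      (λ f g f≗g → Ψ-cong (lift 1 f) (lift 1 g) (λ { zero → refl ; (suc y) → cong suc (f≗g y) })))
  where
  lifted : ∀ j k → R (suc j) (suc (punchIn j k)) * Ψ (lift 1 (λ x → punchIn j (punchIn k x)))
                 ≡ R (suc j) (suc (punchIn j k)) * Ψ (λ x → punchIn (suc j) (punchIn (suc k) x))
  lifted j k = cong (R (suc j) (suc (punchIn j k)) *_) (Ψ-cong _ _ (λ { zero → refl ; (suc y) → refl }))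

doubleExpansion : ∀ n (u v : Fin (suc (suc n)) → ℚ) (A : Fin n → Fin (suc (suc n)) → ℚ) → ℚ
doubleExpansion n u v A = Σ[ suc (suc n) ] (λ j → Σ[ suc n ] (λ k → sign (toℕ j) * sign (toℕ k) *
  ((u j * v (punchIn j k)) * det n (λ i x → A i (punchIn j (punchIn k x))))))

det-doubleExpansion : ∀ n u v A → det (suc (suc n)) (u ▸ v ▸ A) ≡ doubleExpansion n u v A
det-doubleExpansion n u v A = Σ-cong (suc (suc n)) λ j → begin
  sign (toℕ j) * u j * Σ[ suc n ] (λ k → sign (toℕ k) * v (punchIn j k) * minor j k)
    ≡⟨ Σ-*ˡ (suc n) (sign (toℕ j) * u j) (λ k → sign (toℕ k) * v (punchIn j k) * minor j k) ⟨
  Σ[ suc n ] (λ k → sign (toℕ j) * u j * (sign (toℕ k) * v (punchIn j k) * minor j k))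
    ≡⟨ Σ-cong (suc n) (λ k → solve 5 (λ s a t b d → s :* a :* (t :* b :* d) := s :* t :* ((a :* b) :* d)) refl
         (sign (toℕ j)) (u j) (sign (toℕ k)) (v (punchIn j k)) (minor j k)) ⟩
  _ ∎
  where
  minor : Fin (suc (suc n)) → Fin (suc n) → ℚ
  minor j k = det n (λ i x → A i (punchIn j (punchIn k x)))

-- Expanded along its first two rows, det (u ▸ v ▸ A) + det (v ▸ u ▸ A) is a signed pair sum whose
-- weights u a * v b + v a * u b are symmetric in the pair.
det-swap : ∀ n (u v : Fin (suc (suc n)) → ℚ) (A : Fin n → Fin (suc (suc n)) → ℚ) →
  det (suc (suc n)) (u ▸ v ▸ A) ≡ - det (suc (suc n)) (v ▸ u ▸ A)
det-swap n u v A = inverseˡ-unique ℚₚ.+-0-group _ _ (begin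
  det (suc (suc n)) (u ▸ v ▸ A) + det (suc (suc n)) (v ▸ u ▸ A)
    ≡⟨ cong₂ _+_ (det-doubleExpansion n u v A) (det-doubleExpansion n v u A) ⟩
  doubleExpansion n u v A + doubleExpansion n v u A
    ≡⟨ Σ-distrib-+ (suc (suc n)) (λ j → Σ[ suc n ] (term u v j)) (λ j → Σ[ suc n ] (term v u j)) ⟨
  _ ≡⟨ Σ-cong (suc (suc n)) (λ j → sym (Σ-distrib-+ (suc n) (term u v j) (term v u j))) ⟩
  _ ≡⟨ Σ-cong (suc (suc n)) (λ j → Σ-cong (suc n) (λ k →
         solve 4 (λ s a b d → s :* (a :* d) :+ s :* (b :* d) := s :* ((a :+ b) :* d)) refl
           (sign (toℕ j) * sign (toℕ k)) (u j * v (punchIn j k)) (v j * u (punchIn j k)) (minor j k))) ⟩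
  signedPairSum (suc n) pairTerm
    ≡⟨ signedPairSum-symmetric (suc n) pairTerm (minorTerms-swapSymmetric n R Ψ R-sym
         (λ f g f≗g → det-cong n (λ i x → cong (A i) (f≗g x)))) ⟩
  0ℚ ∎)
  where
  R : Fin (suc (suc n)) → Fin (suc (suc n)) → ℚ
  R a b = u a * v b + v a * u b
  R-sym : ∀ a b → R a b ≡ R b a
  R-sym a b = solve 4 (λ w x y z → w :* x :+ y :* z := z :* y :+ x :* w) refl (u a) (v b) (v a) (u b)
  Ψ : (Fin n → Fin (suc (suc n))) → ℚ
  Ψ f = det n (λ i x → A i (f x))
  minor : Fin (suc (suc n)) → Fin (suc n) → ℚ
  minor j k = Ψ (λ x → punchIn j (punchIn k x))
  pairTerm : Fin (suc (suc n)) → Fin (suc n) → ℚ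
  pairTerm j k = R j (punchIn j k) * minor j k
  term : (Fin (suc (suc n)) → ℚ) → (Fin (suc (suc n)) → ℚ) → Fin (suc (suc n)) → Fin (suc n) → ℚ
  term a b j k = sign (toℕ j) * sign (toℕ k) * ((a j * b (punchIn j k)) * minor j k)

det-linearˡ : ∀ m (w u v : Fin (suc m) → ℚ) (a b : ℚ) (A : Fin m → Fin (suc m) → ℚ) →
  (∀ k → w k ≡ a * u k + b * v k) →
  det (suc m) (w ▸ A) ≡ a * det (suc m) (u ▸ A) + b * det (suc m) (v ▸ A)
det-linearˡ m w u v a b A w≡au+bv = begin
  Σ[ suc m ] (λ j → sign (toℕ j) * w j * minor j)
    ≡⟨ Σ-cong (suc m) (λ j → trans (cong (λ z → sign (toℕ j) * z * minor j) (w≡au+bv j))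
         (solve 6 (λ s a u b v d → s :* (a :* u :+ b :* v) :* d := a :* (s :* u :* d) :+ b :* (s :* v :* d)) refl
            (sign (toℕ j)) a (u j) b (v j) (minor j))) ⟩
  Σ[ suc m ] (λ j → a * (sign (toℕ j) * u j * minor j) + b * (sign (toℕ j) * v j * minor j))
    ≡⟨ Σ-distrib-+ (suc m) (λ j → a * (sign (toℕ j) * u j * minor j)) (λ j → b * (sign (toℕ j) * v j * minor j)) ⟩
  _ ≡⟨ cong₂ _+_ (Σ-*ˡ (suc m) a (λ j → sign (toℕ j) * u j * minor j))
                 (Σ-*ˡ (suc m) b (λ j → sign (toℕ j) * v j * minor j)) ⟩
  _ ∎
  where
  minor : Fin (suc m) → ℚ
  minor j = det m (λ i k → A i (punchIn j k))

det-basis▸ : ∀ m (j : Fin (suc m)) (A : Fin m → Fin (suc m) → ℚ) →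
  det (suc m) (basis j ▸ A) ≡ sign (toℕ j) * det m (λ i k → A i (punchIn j k))
det-basis▸ m j A = trans
  (Σ-cong (suc m) (λ k → solve 3 (λ s b d → s :* b :* d := b :* (s :* d)) refl
    (sign (toℕ k)) (basis j k) (det m (λ i x → A i (punchIn k x)))))
  (Σ-basisˡ (suc m) j (λ k → sign (toℕ k) * det m (λ i x → A i (punchIn k x))))

module _ (α β : ℚ) where

  det-ones▸αI+βJ : ∀ m → det (suc m) ((λ _ → 1ℚ) ▸ (λ i k → α * basis (suc i) k + β)) ≡ α ^ m
  det-ones▸αI+βJ zero    = refl
  det-ones▸αI+βJ (suc m) = begin
    det (suc (suc m)) (ones ▸ row₁ ▸ rest)
      ≡⟨ det-swap m ones row₁ rest ⟩
    - det (suc (suc m)) (row₁ ▸ ones ▸ rest)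
      ≡⟨ cong -_ (det-linearˡ (suc m) row₁ (basis (suc zero)) ones α β (ones ▸ rest)
           (λ k → cong (α * basis (suc zero) k +_) (sym (ℚₚ.*-identityʳ β)))) ⟩
    - (α * det (suc (suc m)) (basis (suc zero) ▸ ones ▸ rest) + β * det (suc (suc m)) (ones ▸ ones ▸ rest))
      ≡⟨ cong₂ (λ d e → - (α * d + β * e)) (det-basis▸ (suc m) (suc zero) (ones ▸ rest))
                                           (x≡-x⇒x≡0 _ (det-swap m ones ones rest)) ⟩
    - (α * (- 1ℚ * det (suc m) (λ i k → (ones ▸ rest) i (punchIn (suc zero) k))) + β * 0ℚ)
      ≡⟨ cong (λ d → - (α * (- 1ℚ * d) + β * 0ℚ)) (det-cong (suc m) minor≡) ⟩
    - (α * (- 1ℚ * det (suc m) (ones ▸ (λ i k → α * basis (suc i) k + β))) + β * 0ℚ)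
      ≡⟨ cong (λ d → - (α * (- 1ℚ * d) + β * 0ℚ)) (det-ones▸αI+βJ m) ⟩
    - (α * (- 1ℚ * (α ^ m)) + β * 0ℚ)
      ≡⟨ solve 3 (λ a b p → :- (a :* (:- con 1ℚ :* p) :+ b :* con 0ℚ) := a :* p) refl α β (α ^ m) ⟩
    α * (α ^ m) ∎
    where
    ones : ∀ {n} → Fin n → ℚ
    ones _ = 1ℚ
    row₁ : Fin (suc (suc m)) → ℚ
    row₁ k = α * basis (suc zero) k + β
    rest : Fin m → Fin (suc (suc m)) → ℚ
    rest i k = α * basis (suc (suc i)) k + β
    minor≡ : ∀ i k → (ones ▸ rest) i (punchIn (suc zero) k) ≡ (ones ▸ (λ i k → α * basis (suc i) k + β)) i k
    minor≡ zero    k       = refl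
    minor≡ (suc i) zero    = refl
    minor≡ (suc i) (suc k) = refl

  det-αI+βJ : ∀ m → det (suc m) (λ i k → α * basis i k + β) ≡ α ^ m * (α + ℕ→ℚ (suc m) * β)
  det-αI+βJ zero    =
    solve 2 (λ a b → con 1ℚ :* (a :* con 1ℚ :+ b) :* con 1ℚ :+ con 0ℚ := con 1ℚ :* (a :+ con 1ℚ :* b)) refl α β
  det-αI+βJ (suc m) = begin
    det (suc (suc m)) (row₀ ▸ rest)
      ≡⟨ det-linearˡ (suc m) row₀ (basis zero) (λ _ → 1ℚ) α β rest
           (λ k → cong (α * basis zero k +_) (sym (ℚₚ.*-identityʳ β))) ⟩
    α * det (suc (suc m)) (basis zero ▸ rest) + β * det (suc (suc m)) ((λ _ → 1ℚ) ▸ rest)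
      ≡⟨ cong₂ (λ d e → α * d + β * e) (det-basis▸ (suc m) zero rest) (det-ones▸αI+βJ (suc m)) ⟩
    α * (1ℚ * det (suc m) (λ i k → α * basis i k + β)) + β * (α * α ^ m)
      ≡⟨ cong (λ d → α * (1ℚ * d) + β * (α * α ^ m)) (det-αI+βJ m) ⟩
    α * (1ℚ * (α ^ m * (α + ℕ→ℚ (suc m) * β))) + β * (α * α ^ m)
      ≡⟨ solve 4 (λ a b p N → a :* (con 1ℚ :* (p :* (a :+ N :* b))) :+ b :* (a :* p)
                               := (a :* p) :* (a :+ (N :+ con 1ℚ) :* b))
           refl α β (α ^ m) (ℕ→ℚ (suc m)) ⟩
    (α * α ^ m) * (α + (ℕ→ℚ (suc m) + 1ℚ) * β)
      ≡⟨ cong (λ N → (α * α ^ m) * (α + N * β)) (ℕ→ℚ-suc (suc m)) ⟨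
    (α * α ^ m) * (α + ℕ→ℚ (suc (suc m)) * β) ∎
    where
    row₀ : Fin (suc (suc m)) → ℚ
    row₀ k = α * basis zero k + β
    rest : Fin (suc m) → Fin (suc (suc m)) → ℚ
    rest i k = α * basis (suc i) k + β

[_]ᵇ : Bool → ℚ
[ b ]ᵇ = if b then 1ℚ else 0ℚ

sumℚ-++ : ∀ (xs ys : List ℚ) → sumℚ (xs ++ ys) ≡ sumℚ xs + sumℚ ys
sumℚ-++ []       ys = sym (ℚₚ.+-identityˡ _)
sumℚ-++ (x ∷ xs) ys = trans (cong (x +_) (sumℚ-++ xs ys)) (sym (ℚₚ.+-assoc x _ _))

module _ {A : Set} where

  sumℚ-cong : ∀ (xs : List A) {f g : A → ℚ} → (∀ x → f x ≡ g x) → sumℚ (map f xs) ≡ sumℚ (map g xs)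
  sumℚ-cong xs f≗g = cong sumℚ (Listₚ.map-cong f≗g xs)

  sumℚ-distrib-+ : ∀ (xs : List A) (f g : A → ℚ) →
    sumℚ (map (λ x → f x + g x) xs) ≡ sumℚ (map f xs) + sumℚ (map g xs)
  sumℚ-distrib-+ []       f g = refl
  sumℚ-distrib-+ (x ∷ xs) f g = trans (cong ((f x + g x) +_) (sumℚ-distrib-+ xs f g))
    (solve 4 (λ a b c d → (a :+ b) :+ (c :+ d) := (a :+ c) :+ (b :+ d)) refl (f x) (g x) _ _)

  sumℚ-neg : ∀ (xs : List A) (f : A → ℚ) → sumℚ (map (λ x → - f x) xs) ≡ - sumℚ (map f xs)
  sumℚ-neg []       f = refl
  sumℚ-neg (x ∷ xs) f = trans (cong (- f x +_) (sumℚ-neg xs f))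
    (solve 2 (λ a b → :- a :+ :- b := :- (a :+ b)) refl (f x) _)

  sumℚ-distrib-- : ∀ (xs : List A) (f g : A → ℚ) →
    sumℚ (map (λ x → f x - g x) xs) ≡ sumℚ (map f xs) - sumℚ (map g xs)
  sumℚ-distrib-- xs f g = trans (sumℚ-distrib-+ xs f (λ x → - g x)) (cong (sumℚ (map f xs) +_) (sumℚ-neg xs g))

  sumℚ-zero : ∀ (xs : List A) → sumℚ (map (λ _ → 0ℚ) xs) ≡ 0ℚ
  sumℚ-zero []       = refl
  sumℚ-zero (x ∷ xs) = cong (0ℚ +_) (sumℚ-zero xs)

  sumℚ-filter : ∀ {ℓ} {P : Pred A ℓ} (P? : Decidable P) (g : A → ℚ) (xs : List A) →
    sumℚ (map g (filter P? xs)) ≡ sumℚ (map (λ x → [ does (P? x) ]ᵇ * g x) xs)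
  sumℚ-filter P? g [] = refl
  sumℚ-filter P? g (x ∷ xs) with does (P? x)
  ... | true  = cong₂ _+_ (sym (ℚₚ.*-identityˡ (g x))) (sumℚ-filter P? g xs)
  ... | false = trans (sumℚ-filter P? g xs)
                  (trans (sym (ℚₚ.+-identityˡ _)) (cong (_+ _) (sym (ℚₚ.*-zeroˡ (g x)))))

  ℕ→ℚ-length-filter : ∀ {ℓ} {P : Pred A ℓ} (P? : Decidable P) (xs : List A) →
    ℕ→ℚ (length (filter P? xs)) ≡ sumℚ (map (λ x → [ does (P? x) ]ᵇ) xs)
  ℕ→ℚ-length-filter P? [] = refl
  ℕ→ℚ-length-filter P? (x ∷ xs) with does (P? x)
  ... | true  = trans (ℕ→ℚ-suc (length (filter P? xs)))
                  (trans (ℚₚ.+-comm (ℕ→ℚ (length (filter P? xs))) 1ℚ) (cong (1ℚ +_) (ℕ→ℚ-length-filter P? xs)))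
  ... | false = trans (ℕ→ℚ-length-filter P? xs) (sym (ℚₚ.+-identityˡ _))

sumℚ-map-∘ : ∀ {A B : Set} (xs : List A) (g : B → ℚ) (f : A → B) →
  sumℚ (map g (map f xs)) ≡ sumℚ (map (λ x → g (f x)) xs)
sumℚ-map-∘ xs g f = cong sumℚ (sym (Listₚ.map-∘ xs))

pairsOf : ∀ {A B : Set} → List A → List B → List (A × B)
pairsOf as bs = concatMap (λ a → map (a ,_) bs) as

sumℚ-pairsOf : ∀ {A B : Set} (as : List A) (bs : List B) (G : A × B → ℚ) →
  sumℚ (map G (pairsOf as bs)) ≡ sumℚ (map (λ a → sumℚ (map (λ b → G (a , b)) bs)) as)
sumℚ-pairsOf []       bs G = refl
sumℚ-pairsOf (a ∷ as) bs G = begin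
  sumℚ (map G (map (a ,_) bs ++ pairsOf as bs))
    ≡⟨ cong sumℚ (Listₚ.map-++ G (map (a ,_) bs) (pairsOf as bs)) ⟩
  sumℚ (map G (map (a ,_) bs) ++ map G (pairsOf as bs))
    ≡⟨ sumℚ-++ (map G (map (a ,_) bs)) (map G (pairsOf as bs)) ⟩
  _ ≡⟨ cong₂ _+_ (sumℚ-map-∘ bs G (a ,_)) (sumℚ-pairsOf as bs G) ⟩
  _ ∎

∈-pairsOf : ∀ {A B : Set} {a : A} {b : B} {as : List A} {bs : List B} →
  a ∈ as → b ∈ bs → (a , b) ∈ pairsOf as bs
∈-pairsOf {as = a ∷ as} {bs} (here refl) b∈bs = ∈ₚ.∈-++⁺ˡ (∈ₚ.∈-map⁺ (a ,_) b∈bs)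
∈-pairsOf {as = x ∷ as} {bs} (there a∈as) b∈bs = ∈ₚ.∈-++⁺ʳ (map (x ,_) bs) (∈-pairsOf a∈as b∈bs)

Σ-subsets : ∀ n → (Subset n → ℚ) → ℚ
Σ-subsets n g = sumℚ (map g (allSubsets n))

Σ-pairs : ∀ n → (Subset n → Subset n → ℚ) → ℚ
Σ-pairs n G = Σ-subsets n (λ p → Σ-subsets n (G p))

Σ-subsets-cong : ∀ n {f g : Subset n → ℚ} → (∀ p → f p ≡ g p) → Σ-subsets n f ≡ Σ-subsets n g
Σ-subsets-cong n = sumℚ-cong (allSubsets n)

Σ-subsets-suc : ∀ n g → Σ-subsets (suc n) g ≡ Σ-subsets n (λ p → g (true ∷ p)) + Σ-subsets n (λ p → g (false ∷ p))
Σ-subsets-suc n g = begin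
  sumℚ (map g (map (true ∷_) (allSubsets n) ++ map (false ∷_) (allSubsets n)))
    ≡⟨ cong sumℚ (Listₚ.map-++ g (map (true ∷_) (allSubsets n)) _) ⟩
  _ ≡⟨ sumℚ-++ (map g (map (true ∷_) (allSubsets n))) _ ⟩
  _ ≡⟨ cong₂ _+_ (sumℚ-map-∘ (allSubsets n) g (true ∷_)) (sumℚ-map-∘ (allSubsets n) g (false ∷_)) ⟩
  _ ∎

Σ-subsets-insertAt : ∀ m (i : Fin (suc m)) g →
  Σ-subsets (suc m) g ≡ Σ-subsets m (λ p → g (insertAt p i true)) + Σ-subsets m (λ p → g (insertAt p i false))
Σ-subsets-insertAt m       zero    g = Σ-subsets-suc m g
Σ-subsets-insertAt (suc m) (suc i) g = begin
  Σ-subsets (suc (suc m)) g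
    ≡⟨ Σ-subsets-suc (suc m) g ⟩
  Σ-subsets (suc m) (λ p → g (true ∷ p)) + Σ-subsets (suc m) (λ p → g (false ∷ p))
    ≡⟨ cong₂ _+_ (Σ-subsets-insertAt m i (λ p → g (true ∷ p))) (Σ-subsets-insertAt m i (λ p → g (false ∷ p))) ⟩
  (s true true + s true false) + (s false true + s false false)
    ≡⟨ solve 4 (λ a b c d → (a :+ b) :+ (c :+ d) := (a :+ c) :+ (b :+ d)) refl
         (s true true) (s true false) (s false true) (s false false) ⟩
  (s true true + s false true) + (s true false + s false false)
    ≡⟨ cong₂ _+_ (Σ-subsets-suc m (λ p → g (insertAt p (suc i) true)))
                 (Σ-subsets-suc m (λ p → g (insertAt p (suc i) false))) ⟨
  Σ-subsets (suc m) (λ p → g (insertAt p (suc i) true)) + Σ-subsets (suc m) (λ p → g (insertAt p (suc i) false)) ∎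
  where
  s : Bool → Bool → ℚ
  s x y = Σ-subsets m (λ p → g (x ∷ insertAt p i y))

Σ-pairs-cong : ∀ n {F G : Subset n → Subset n → ℚ} → (∀ p q → F p q ≡ G p q) → Σ-pairs n F ≡ Σ-pairs n G
Σ-pairs-cong n F≡G = Σ-subsets-cong n (λ p → Σ-subsets-cong n (F≡G p))

Σ-pairs-distrib-+ : ∀ n (F G : Subset n → Subset n → ℚ) →
  Σ-pairs n (λ p q → F p q + G p q) ≡ Σ-pairs n F + Σ-pairs n G
Σ-pairs-distrib-+ n F G = trans (Σ-subsets-cong n (λ p → sumℚ-distrib-+ (allSubsets n) (F p) (G p)))
  (sumℚ-distrib-+ (allSubsets n) (λ p → Σ-subsets n (F p)) (λ p → Σ-subsets n (G p)))

Σ-pairs-zero : ∀ n → Σ-pairs n (λ _ _ → 0ℚ) ≡ 0ℚ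
Σ-pairs-zero n = trans (Σ-subsets-cong n (λ _ → sumℚ-zero (allSubsets n))) (sumℚ-zero (allSubsets n))

Σ-Σ-pairs : ∀ n m (G : Fin n → Subset m → Subset m → ℚ) →
  Σ[ n ] (λ j → Σ-pairs m (G j)) ≡ Σ-pairs m (λ p q → Σ[ n ] (λ j → G j p q))
Σ-Σ-pairs zero    m G = sym (Σ-pairs-zero m)
Σ-Σ-pairs (suc n) m G = trans (cong (Σ-pairs m (G zero) +_) (Σ-Σ-pairs n m (λ j → G (suc j))))
  (sym (Σ-pairs-distrib-+ m (G zero) (λ p q → Σ[ n ] (λ j → G (suc j) p q))))

ΣBool² : (Bool → Bool → ℚ) → ℚ
ΣBool² h = (h true true + h true false) + (h false true + h false false)

ΣBool²-cong : ∀ {f g : Bool → Bool → ℚ} → (∀ x y → f x y ≡ g x y) → ΣBool² f ≡ ΣBool² g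
ΣBool²-cong f≡g = cong₂ _+_ (cong₂ _+_ (f≡g true true) (f≡g true false)) (cong₂ _+_ (f≡g false true) (f≡g false false))

Σ-pairs-insertAt : ∀ m (i : Fin (suc m)) G →
  Σ-pairs (suc m) G ≡ ΣBool² (λ x y → Σ-pairs m (λ p q → G (insertAt p i x) (insertAt q i y)))
Σ-pairs-insertAt m i G = begin
  Σ-subsets (suc m) (λ p → Σ-subsets (suc m) (G p))
    ≡⟨ Σ-subsets-cong (suc m) (λ p → Σ-subsets-insertAt m i (G p)) ⟩
  Σ-subsets (suc m) (λ p → inner true p + inner false p)
    ≡⟨ sumℚ-distrib-+ (allSubsets (suc m)) (inner true) (inner false) ⟩
  Σ-subsets (suc m) (inner true) + Σ-subsets (suc m) (inner false)
    ≡⟨ cong₂ _+_ (Σ-subsets-insertAt m i (inner true)) (Σ-subsets-insertAt m i (inner false)) ⟩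
  (s true true + s false true) + (s true false + s false false)
    ≡⟨ solve 4 (λ a b c d → (a :+ b) :+ (c :+ d) := (a :+ c) :+ (b :+ d)) refl
         (s true true) (s false true) (s true false) (s false false) ⟩
  ΣBool² s ∎
  where
  inner : Bool → Subset (suc m) → ℚ
  inner y p = Σ-subsets m (λ q → G p (insertAt q i y))
  s : Bool → Bool → ℚ
  s x y = Σ-pairs m (λ p q → G (insertAt p i x) (insertAt q i y))

sucIf : Bool → ℕ → ℕ
sucIf true  n = suc n
sucIf false n = n

∣insertAt∣ : ∀ {m} (p : Subset m) (i : Fin (suc m)) (x : Bool) → ∣ insertAt p i x ∣ ≡ sucIf x ∣ p ∣
∣insertAt∣ p           zero    true  = refl
∣insertAt∣ p           zero    false = refl
∣insertAt∣ (true ∷ p)  (suc i) true  = cong suc (∣insertAt∣ p i true)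
∣insertAt∣ (true ∷ p)  (suc i) false = cong suc (∣insertAt∣ p i false)
∣insertAt∣ (false ∷ p) (suc i) x     = ∣insertAt∣ p i x

insertAt-∩ : ∀ {m} (p q : Subset m) (i : Fin (suc m)) (x y : Bool) →
  insertAt p i x ∩ insertAt q i y ≡ insertAt (p ∩ q) i (x ∧ y)
insertAt-∩ p       q       zero    x y = refl
insertAt-∩ (a ∷ p) (b ∷ q) (suc i) x y = cong ((a ∧ b) ∷_) (insertAt-∩ p q i x y)

∩-shared⇒nonempty : ∀ {m} (p q : Subset m) (i : Fin m) →
  lookup p i ≡ true → lookup q i ≡ true → (∣ p ∩ q ∣ ≡ᵇ 0) ≡ false
∩-shared⇒nonempty (true ∷ p)  (true ∷ q)  zero    _   _   = refl
∩-shared⇒nonempty (true ∷ p)  (true ∷ q)  (suc i) _   _   = refl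
∩-shared⇒nonempty (true ∷ p)  (false ∷ q) (suc i) p∋i q∋i = ∩-shared⇒nonempty p q i p∋i q∋i
∩-shared⇒nonempty (false ∷ p) (b ∷ q)     (suc i) p∋i q∋i = ∩-shared⇒nonempty p q i p∋i q∋i

isEdgeᵇ : ℕ → ℕ → ℕ → ℕ → Bool
isEdgeᵇ c a b d = (a ≡ᵇ c) ∧ (b ≡ᵇ c) ∧ (d ≡ᵇ 0)

-- Whether (p , q), completed by coordinates already split off, is an edge: f, g and k add the
-- contributions of those coordinates to ∣ p ∣, ∣ q ∣ and ∣ p ∩ q ∣.
shiftedEdge : ℕ → (ℕ → ℕ) → (ℕ → ℕ) → (ℕ → ℕ) → ∀ {m} → Subset m → Subset m → ℚ
shiftedEdge c f g k p q = [ isEdgeᵇ c (f ∣ p ∣) (g ∣ q ∣) (k ∣ p ∩ q ∣) ]ᵇ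

isEdge : ℕ → ∀ {m} → Subset m → Subset m → ℚ
isEdge c = shiftedEdge c (λ a → a) (λ a → a) (λ a → a)

shiftedEdge-insertAt : ∀ c {m} f g k (p q : Subset m) i x y →
  shiftedEdge c f g k (insertAt p i x) (insertAt q i y)
    ≡ shiftedEdge c (λ a → f (sucIf x a)) (λ a → g (sucIf y a)) (λ a → k (sucIf (x ∧ y) a)) p q
shiftedEdge-insertAt c f g k p q i x y
  rewrite ∣insertAt∣ p i x | ∣insertAt∣ q i y | insertAt-∩ p q i x y | ∣insertAt∣ (p ∩ q) i (x ∧ y) = refl

isEdge*size-difference≡0 : ∀ c a b d → [ isEdgeᵇ c a b d ]ᵇ * (ℕ→ℚ a - ℕ→ℚ b) ≡ 0ℚ
isEdge*size-difference≡0 c a b d with a ≡ᵇ c in a≡c | b ≡ᵇ c in b≡c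
... | false | _     = ℚₚ.*-zeroˡ (ℕ→ℚ a - ℕ→ℚ b)
... | true  | false = ℚₚ.*-zeroˡ (ℕ→ℚ a - ℕ→ℚ b)
... | true  | true
  rewrite ℕₚ.≡ᵇ⇒≡ a c (Equivalence.from Boolₚ.T-≡ a≡c) | ℕₚ.≡ᵇ⇒≡ b c (Equivalence.from Boolₚ.T-≡ b≡c) =
  trans (cong ([ d ≡ᵇ 0 ]ᵇ *_) (ℚₚ.+-inverseʳ (ℕ→ℚ c))) (ℚₚ.*-zeroʳ [ d ≡ᵇ 0 ]ᵇ)

incidence : ∀ {m} → Subset m → Subset m → Fin m → ℚ
incidence p q i = ind p i - ind q i

incidence-insertAt : ∀ {m} (p q : Subset m) i x y →
  incidence (insertAt p i x) (insertAt q i y) i ≡ [ x ]ᵇ - [ y ]ᵇ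
incidence-insertAt p q i x y rewrite Vecₚ.insertAt-lookup p i x | Vecₚ.insertAt-lookup q i y = refl

incidence-insertAt-punchIn : ∀ {m} (p q : Subset m) i x y j →
  incidence (insertAt p i x) (insertAt q i y) (punchIn i j) ≡ incidence p q j
incidence-insertAt-punchIn p q i x y j
  rewrite Vecₚ.insertAt-punchIn p i x j | Vecₚ.insertAt-punchIn q i y j = refl

Σ-ind : ∀ n (p : Subset n) → Σ[ n ] (ind p) ≡ ℕ→ℚ ∣ p ∣
Σ-ind zero    []          = refl
Σ-ind (suc n) (true ∷ p)  =
  trans (cong (1ℚ +_) (Σ-ind n p)) (trans (ℚₚ.+-comm 1ℚ (ℕ→ℚ ∣ p ∣)) (sym (ℕ→ℚ-suc ∣ p ∣)))
Σ-ind (suc n) (false ∷ p) = trans (ℚₚ.+-identityˡ _) (Σ-ind n p)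

gram : ℕ → ∀ n → Fin n → Fin n → ℚ
gram c n i j = Σ-pairs n (λ p q → isEdge c p q * (incidence p q i * incidence p q j))

-- What is left of an off-diagonal entry of the Gram matrix once its two coordinates are split off;
-- it no longer mentions them.
gramOffDiagonal : ℕ → ℕ → ℚ
gramOffDiagonal c m = ΣBool² (λ x y → ΣBool² (λ x′ y′ → Σ-pairs m (λ p q →
  shiftedEdge c (λ a → sucIf x (sucIf x′ a)) (λ a → sucIf y (sucIf y′ a))
                (λ a → sucIf (x ∧ y) (sucIf (x′ ∧ y′) a)) p q
    * (([ x ]ᵇ - [ y ]ᵇ) * ([ x′ ]ᵇ - [ y′ ]ᵇ)))))

gram-offDiagonal : ∀ c m (i : Fin (suc (suc m))) (j : Fin (suc m)) → gram c (suc (suc m)) i (punchIn i j) ≡ gramOffDiagonal c m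
gram-offDiagonal c m i j = begin
  gram c (suc (suc m)) i (punchIn i j)
    ≡⟨ Σ-pairs-insertAt (suc m) i (λ p q → isEdge c p q * (incidence p q i * incidence p q (punchIn i j))) ⟩
  _ ≡⟨ ΣBool²-cong (λ x y → Σ-pairs-cong (suc m) (λ p q → cong₂ _*_
         (shiftedEdge-insertAt c (λ a → a) (λ a → a) (λ a → a) p q i x y)
         (cong₂ _*_ (incidence-insertAt p q i x y) (incidence-insertAt-punchIn p q i x y j)))) ⟩
  ΣBool² (λ x y → Σ-pairs (suc m) (λ p q →
    shiftedEdge c (sucIf x) (sucIf y) (sucIf (x ∧ y)) p q * (([ x ]ᵇ - [ y ]ᵇ) * incidence p q j)))
    ≡⟨ ΣBool²-cong (λ x y → splitAt-j (sucIf x) (sucIf y) (sucIf (x ∧ y)) ([ x ]ᵇ - [ y ]ᵇ)) ⟩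
  gramOffDiagonal c m ∎
  where
  splitAt-j : ∀ f g k w →
    Σ-pairs (suc m) (λ p q → shiftedEdge c f g k p q * (w * incidence p q j))
      ≡ ΣBool² (λ x y → Σ-pairs m (λ p q →
          shiftedEdge c (λ a → f (sucIf x a)) (λ a → g (sucIf y a)) (λ a → k (sucIf (x ∧ y) a)) p q
            * (w * ([ x ]ᵇ - [ y ]ᵇ))))
  splitAt-j f g k w = trans (Σ-pairs-insertAt m j (λ p q → shiftedEdge c f g k p q * (w * incidence p q j)))
    (ΣBool²-cong (λ x y → Σ-pairs-cong m (λ p q →
      cong₂ (λ e t → e * (w * t)) (shiftedEdge-insertAt c f g k p q j x y) (incidence-insertAt p q j x y))))

gram-rowSum : ∀ c n (i : Fin n) → Σ[ n ] (gram c n i) ≡ 0ℚ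
gram-rowSum c n i = begin
  Σ[ n ] (gram c n i)
    ≡⟨ Σ-Σ-pairs n n (λ j p q → isEdge c p q * (incidence p q i * incidence p q j)) ⟩
  Σ-pairs n (λ p q → Σ[ n ] (λ j → isEdge c p q * (incidence p q i * incidence p q j)))
    ≡⟨ Σ-pairs-cong n edgeRow≡0 ⟩
  Σ-pairs n (λ _ _ → 0ℚ)
    ≡⟨ Σ-pairs-zero n ⟩
  0ℚ ∎
  where
  edgeRow≡0 : ∀ p q → Σ[ n ] (λ j → isEdge c p q * (incidence p q i * incidence p q j)) ≡ 0ℚ
  edgeRow≡0 p q = begin
    Σ[ n ] (λ j → e * (t i * t j))   ≡⟨ Σ-*ˡ n e (λ j → t i * t j) ⟩
    e * Σ[ n ] (λ j → t i * t j)     ≡⟨ cong (e *_) (Σ-*ˡ n (t i) t) ⟩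
    e * (t i * Σ[ n ] t)
      ≡⟨ cong (λ s → e * (t i * s)) (trans (Σ-distrib-- n (ind p) (ind q)) (cong₂ _-_ (Σ-ind n p) (Σ-ind n q))) ⟩
    e * (t i * (ℕ→ℚ (∣ p ∣) - ℕ→ℚ (∣ q ∣)))
      ≡⟨ solve 3 (λ e t d → e :* (t :* d) := t :* (e :* d)) refl e (t i) (ℕ→ℚ (∣ p ∣) - ℕ→ℚ (∣ q ∣)) ⟩
    t i * (e * (ℕ→ℚ (∣ p ∣) - ℕ→ℚ (∣ q ∣)))
      ≡⟨ cong (t i *_) (isEdge*size-difference≡0 c (∣ p ∣) (∣ q ∣) (∣ p ∩ q ∣)) ⟩
    t i * 0ℚ                          ≡⟨ ℚₚ.*-zeroʳ (t i) ⟩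
    0ℚ ∎
    where
    e = isEdge c p q
    t = incidence p q

does-≟true : ∀ b → does (b Bool.≟ true) ≡ b
does-≟true true  = refl
does-≟true false = refl

edgeVal-basis : ∀ {n} (h : Hyperedge n) j → edgeVal h (basis j) ≡ incidence (h-in h) (h-out h) j
edgeVal-basis {n} h j = cong₂ _-_ (Σ-basisʳ n j (ind (h-in h))) (Σ-basisʳ n j (ind (h-out h)))

sumℚ-completeHypergraph : ∀ n c (g : Hyperedge n → ℚ) →
  sumℚ (map g (completeHypergraph n c)) ≡ Σ-pairs n (λ p q → isEdge c p q * g (p , q))
sumℚ-completeHypergraph n c g = begin
  sumℚ (map g (completeHypergraph n c))
    ≡⟨ sumℚ-filter edge? g (pairsOf (allSubsets n) (allSubsets n)) ⟩
  sumℚ (map (λ h → [ does (edge? h) ]ᵇ * g h) (pairsOf (allSubsets n) (allSubsets n)))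
    ≡⟨ sumℚ-pairsOf (allSubsets n) (allSubsets n) (λ h → [ does (edge? h) ]ᵇ * g h) ⟩
  Σ-pairs n (λ p q → [ does (edge? (p , q)) ]ᵇ * g (p , q))
    ≡⟨ Σ-pairs-cong n (λ p q → cong (λ b → [ b ]ᵇ * g (p , q))
                                    (does-≟true (isEdgeᵇ c (∣ p ∣) (∣ q ∣) (∣ p ∩ q ∣)))) ⟩
  Σ-pairs n (λ p q → isEdge c p q * g (p , q)) ∎
  where
  edge? = λ (h : Hyperedge n) → isEdgeᵇ c (∣ h-in h ∣) (∣ h-out h ∣) (∣ h-in h ∩ h-out h ∣) Bool.≟ true

laplacianMatrix≡gram : ∀ n c (i j : Fin n) →
  laplacianMatrix (completeHypergraph n c) i j ≡ frac 1 (deg (completeHypergraph n c) i) * gram c n i j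
laplacianMatrix≡gram n c i j = cong (frac 1 (deg H i) *_) (begin
  sumℚ (map (λ h → ind (h-in h) i * edgeVal h (basis j)) H) - sumℚ (map (λ h → ind (h-out h) i * edgeVal h (basis j)) H)
    ≡⟨ sumℚ-distrib-- H (λ h → ind (h-in h) i * edgeVal h (basis j)) (λ h → ind (h-out h) i * edgeVal h (basis j)) ⟨
  sumℚ (map (λ h → ind (h-in h) i * edgeVal h (basis j) - ind (h-out h) i * edgeVal h (basis j)) H)
    ≡⟨ sumℚ-cong H (λ h → trans (cong (λ e → ind (h-in h) i * e - ind (h-out h) i * e) (edgeVal-basis h j))
         (solve 3 (λ a b e → a :* e :- b :* e := (a :- b) :* e) refl (ind (h-in h) i) (ind (h-out h) i) _)) ⟩
  sumℚ (map (λ h → incidence (h-in h) (h-out h) i * incidence (h-in h) (h-out h) j) H)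
    ≡⟨ sumℚ-completeHypergraph n c (λ h → incidence (h-in h) (h-out h) i * incidence (h-in h) (h-out h) j) ⟩
  gram c n i j ∎)
  where
  H = completeHypergraph n c

-- An edge cannot contain i both as a head and as a tail, so the square of its incidence at i is
-- exactly the indicator that it contains i.
isEdge*contains≡isEdge*incidence² : ∀ c {n} (p q : Subset n) (i : Fin n) →
  isEdge c p q * [ lookup p i ∨ lookup q i ]ᵇ ≡ isEdge c p q * (incidence p q i * incidence p q i)
isEdge*contains≡isEdge*incidence² c p q i with lookup p i in p∋i | lookup q i in q∋i
... | false | false = refl
... | true  | false = refl
... | false | true  = refl
... | true  | true
  rewrite ∩-shared⇒nonempty p q i p∋i q∋i | Boolₚ.∧-zeroʳ (∣ q ∣ ≡ᵇ c) | Boolₚ.∧-zeroʳ (∣ p ∣ ≡ᵇ c) = refl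

ℕ→ℚ-deg≡gram : ∀ n c (i : Fin n) → ℕ→ℚ (deg (completeHypergraph n c) i) ≡ gram c n i i
ℕ→ℚ-deg≡gram n c i = begin
  ℕ→ℚ (length (filter contains? H))
    ≡⟨ ℕ→ℚ-length-filter contains? H ⟩
  sumℚ (map (λ h → [ does (contains? h) ]ᵇ) H)
    ≡⟨ sumℚ-completeHypergraph n c (λ h → [ does (contains? h) ]ᵇ) ⟩
  Σ-pairs n (λ p q → isEdge c p q * [ does (contains? (p , q)) ]ᵇ)
    ≡⟨ Σ-pairs-cong n (λ p q → trans (cong (λ b → isEdge c p q * [ b ]ᵇ) (does-≟true (lookup p i ∨ lookup q i)))
                                       (isEdge*contains≡isEdge*incidence² c p q i)) ⟩
  gram c n i i ∎
  where
  H = completeHypergraph n c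
  contains? = λ (h : Hyperedge n) → (lookup (h-in h) i ∨ lookup (h-out h) i) Bool.≟ true

∈-allSubsets : ∀ n (p : Subset n) → p ∈ allSubsets n
∈-allSubsets zero    []          = here refl
∈-allSubsets (suc n) (true ∷ p)  = ∈ₚ.∈-++⁺ˡ (∈ₚ.∈-map⁺ (true ∷_) (∈-allSubsets n p))
∈-allSubsets (suc n) (false ∷ p) = ∈ₚ.∈-++⁺ʳ (map (true ∷_) (allSubsets n)) (∈ₚ.∈-map⁺ (false ∷_) (∈-allSubsets n p))

disjointPair : ∀ m a b → a ℕ.+ b ≤ m →
  ∃ λ (p : Subset m) → ∃ λ (q : Subset m) → ∣ p ∣ ≡ a × ∣ q ∣ ≡ b × ∣ p ∩ q ∣ ≡ 0
disjointPair zero    zero    zero    _ = [] , [] , refl , refl , refl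
disjointPair (suc m) (suc a) b (s≤s a+b≤m) with disjointPair m a b a+b≤m
... | p , q , ∣p∣≡a , ∣q∣≡b , disjoint = true ∷ p , false ∷ q , cong suc ∣p∣≡a , ∣q∣≡b , disjoint
disjointPair (suc m) zero (suc b) (s≤s b≤m) with disjointPair m zero b b≤m
... | p , q , ∣p∣≡0 , ∣q∣≡b , disjoint = false ∷ p , true ∷ q , ∣p∣≡0 , cong suc ∣q∣≡b , disjoint
disjointPair (suc m) zero zero _ with disjointPair m zero zero z≤n
... | p , q , ∣p∣≡0 , ∣q∣≡0 , disjoint = false ∷ p , false ∷ q , ∣p∣≡0 , ∣q∣≡0 , disjoint

deg-positive : ∀ m c → 2 ℕ.* suc c ≤ suc m → (i : Fin (suc m)) →
  ∃ λ d → deg (completeHypergraph (suc m) (suc c)) i ≡ suc d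
deg-positive m c (s≤s c+c+1≤m) i with disjointPair m c (suc c) (subst (λ k → c ℕ.+ suc k ≤ m) (ℕₚ.+-identityʳ c) c+c+1≤m)
... | p , q , ∣p∣≡c , ∣q∣≡c+1 , disjoint = nonemptyLength
  (∈ₚ.∈-filter⁺ contains?
    (∈ₚ.∈-filter⁺ edge? (∈-pairsOf (∈-allSubsets _ head) (∈-allSubsets _ tail)) headTailEdge)
    containsI)
  where
  head = insertAt p i true
  tail = insertAt q i false
  edge? = λ (h : Hyperedge (suc m)) → isEdgeᵇ (suc c) (∣ h-in h ∣) (∣ h-out h ∣) (∣ h-in h ∩ h-out h ∣) Bool.≟ true
  contains? = λ (h : Hyperedge (suc m)) → (lookup (h-in h) i ∨ lookup (h-out h) i) Bool.≟ true
  headTailEdge : isEdgeᵇ (suc c) (∣ head ∣) (∣ tail ∣) (∣ head ∩ tail ∣) ≡ true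
  headTailEdge rewrite ∣insertAt∣ p i true | ∣insertAt∣ q i false | insertAt-∩ p q i true false
               | ∣insertAt∣ (p ∩ q) i false | ∣p∣≡c | ∣q∣≡c+1 | disjoint
               | Equivalence.to Boolₚ.T-≡ (ℕₚ.≡⇒≡ᵇ c c refl) = refl
  containsI : (lookup head i ∨ lookup tail i) ≡ true
  containsI rewrite Vecₚ.insertAt-lookup p i true = refl
  nonemptyLength : ∀ {A : Set} {x : A} {xs : List A} → x ∈ xs → ∃ λ d → length xs ≡ suc d
  nonemptyLength {xs = _ ∷ xs} _ = length xs , refl

deg+offDiagonal≡0 : ∀ c m (i : Fin (suc (suc m))) →
  ℕ→ℚ (deg (completeHypergraph (suc (suc m)) c) i) + ℕ→ℚ (suc m) * gramOffDiagonal c m ≡ 0ℚ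
deg+offDiagonal≡0 c m i = begin
  ℕ→ℚ (deg (completeHypergraph n c) i) + ℕ→ℚ (suc m) * gramOffDiagonal c m
    ≡⟨ cong₂ _+_ (ℕ→ℚ-deg≡gram n c i) (sym (Σ-const (suc m) (gramOffDiagonal c m))) ⟩
  gram c n i i + Σ[ suc m ] (λ _ → gramOffDiagonal c m)
    ≡⟨ cong (gram c n i i +_) (Σ-cong (suc m) (gram-offDiagonal c m i)) ⟨
  gram c n i i + Σ[ suc m ] (λ j → gram c n i (punchIn i j))
    ≡⟨ Σ-punchIn (suc m) i (gram c n i) ⟨
  Σ[ n ] (gram c n i)
    ≡⟨ gram-rowSum c n i ⟩
  0ℚ ∎
  where
  n = suc (suc m)

frac-suc≡1+frac-1 : ∀ m → frac (suc (suc m)) (suc m) ≡ 1ℚ + frac 1 (suc m)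
frac-suc≡1+frac-1 m = begin
  frac (suc (suc m)) (suc m)               ≡⟨ frac≡ℕ→ℚ*frac-1 (suc (suc m)) m ⟩
  ℕ→ℚ (suc (suc m)) * β                    ≡⟨ cong (_* β) (ℕ→ℚ-suc (suc m)) ⟩
  (ℕ→ℚ (suc m) + 1ℚ) * β                   ≡⟨ solve 2 (λ N b → (N :+ con 1ℚ) :* b := b :* N :+ b) refl (ℕ→ℚ (suc m)) β ⟩
  β * ℕ→ℚ (suc m) + β                      ≡⟨ cong (_+ β) (frac-1*ℕ→ℚ m) ⟩
  1ℚ + β                                   ∎
  where
  β = frac 1 (suc m)

laplacianMatrix-diagonal : ∀ n c (i : Fin n) {d} → deg (completeHypergraph n c) i ≡ suc d →
  laplacianMatrix (completeHypergraph n c) i i ≡ 1ℚ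
laplacianMatrix-diagonal n c i {d} deg≡1+d = begin
  laplacianMatrix (completeHypergraph n c) i i
    ≡⟨ laplacianMatrix≡gram n c i i ⟩
  frac 1 (deg (completeHypergraph n c) i) * gram c n i i
    ≡⟨ cong (λ k → frac 1 k * gram c n i i) deg≡1+d ⟩
  frac 1 (suc d) * gram c n i i
    ≡⟨ cong (frac 1 (suc d) *_) (trans (cong ℕ→ℚ (sym deg≡1+d)) (ℕ→ℚ-deg≡gram n c i)) ⟨
  frac 1 (suc d) * ℕ→ℚ (suc d)
    ≡⟨ frac-1*ℕ→ℚ d ⟩
  1ℚ ∎

laplacianMatrix-offDiagonal : ∀ m c {i j : Fin (suc (suc m))} {d} → deg (completeHypergraph (suc (suc m)) c) i ≡ suc d →
  i ≢ j → laplacianMatrix (completeHypergraph (suc (suc m)) c) i j ≡ - frac 1 (suc m)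
laplacianMatrix-offDiagonal m c {i} {j} {d} deg≡1+d i≢j = begin
  laplacianMatrix (completeHypergraph n c) i j
    ≡⟨ laplacianMatrix≡gram n c i j ⟩
  frac 1 (deg (completeHypergraph n c) i) * gram c n i j
    ≡⟨ cong (λ k → frac 1 k * gram c n i j) deg≡1+d ⟩
  frac 1 (suc d) * gram c n i j
    ≡⟨ cong (λ k → frac 1 (suc d) * gram c n i k) (Finₚ.punchIn-punchOut i≢j) ⟨
  frac 1 (suc d) * gram c n i (punchIn i (punchOut i≢j))
    ≡⟨ cong (frac 1 (suc d) *_) (gram-offDiagonal c m i (punchOut i≢j)) ⟩
  frac 1 (suc d) * gramOffDiagonal c m
    ≡⟨ a+b*e≡0⇒u*e≡-v (frac 1 (suc d)) (ℕ→ℚ (suc d)) (frac 1 (suc m)) (ℕ→ℚ (suc m)) (gramOffDiagonal c m)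
         (frac-1*ℕ→ℚ d) (frac-1*ℕ→ℚ m)
         (trans (cong (λ k → ℕ→ℚ k + ℕ→ℚ (suc m) * gramOffDiagonal c m) (sym deg≡1+d)) (deg+offDiagonal≡0 c m i)) ⟩
  - frac 1 (suc m) ∎
  where
  n = suc (suc m)

laplacianMatrix-complete : ∀ m c → 2 ℕ.* suc c ≤ suc (suc m) → (i j : Fin (suc (suc m))) →
  laplacianMatrix (completeHypergraph (suc (suc m)) (suc c)) i j
    ≡ frac (suc (suc m)) (suc m) * basis i j - frac 1 (suc m)
laplacianMatrix-complete m c 2c≤n i j with deg-positive (suc m) c 2c≤n i | i Finₚ.≟ j
... | d , deg≡1+d | yes refl = begin
  laplacianMatrix (completeHypergraph (suc (suc m)) (suc c)) i i
    ≡⟨ laplacianMatrix-diagonal (suc (suc m)) (suc c) i deg≡1+d ⟩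
  1ℚ
    ≡⟨ solve 1 (λ b → con 1ℚ := (con 1ℚ :+ b) :* con 1ℚ :- b) refl (frac 1 (suc m)) ⟩
  (1ℚ + frac 1 (suc m)) * 1ℚ - frac 1 (suc m)
    ≡⟨ cong (λ f → f * 1ℚ - frac 1 (suc m)) (frac-suc≡1+frac-1 m) ⟨
  frac (suc (suc m)) (suc m) * 1ℚ - frac 1 (suc m) ∎
... | d , deg≡1+d | no i≢j = begin
  laplacianMatrix (completeHypergraph (suc (suc m)) (suc c)) i j
    ≡⟨ laplacianMatrix-offDiagonal m (suc c) deg≡1+d i≢j ⟩
  - frac 1 (suc m)
    ≡⟨ solve 2 (λ f b → :- b := f :* con 0ℚ :- b) refl (frac (suc (suc m)) (suc m)) (frac 1 (suc m)) ⟩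
  frac (suc (suc m)) (suc m) * 0ℚ - frac 1 (suc m) ∎

corollary7 : (n c : ℕ) → 2 ≤ n → 1 ≤ c → 2 ℕ.* c ≤ n →
    (x : ℚ) → charPoly n (laplacianMatrix (completeHypergraph n c)) x
    ≡ (x - 0ℚ) * ((x - frac n (n ∸ 1)) ^ (n ∸ 1))
corollary7 (suc (suc m)) (suc c) (s≤s (s≤s z≤n)) (s≤s z≤n) 2c≤n x = begin
  det n (λ i j → x * basis i j - laplacianMatrix (completeHypergraph n (suc c)) i j)
    ≡⟨ det-cong n (λ i j → trans (cong (λ l → x * basis i j - l) (laplacianMatrix-complete m c 2c≤n i j))
         (solve 4 (λ x b f β → x :* b :- (f :* b :- β) := (x :- f) :* b :+ β) refl x (basis i j) (frac n (suc m)) β)) ⟩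
  det n (λ i j → α * basis i j + β)
    ≡⟨ det-αI+βJ α β (suc m) ⟩
  α ^ suc m * (α + ℕ→ℚ n * β)
    ≡⟨ cong (λ f → α ^ suc m * (x - f + ℕ→ℚ n * β)) (frac≡ℕ→ℚ*frac-1 n m) ⟩
  α ^ suc m * (x - ℕ→ℚ n * β + ℕ→ℚ n * β)
    ≡⟨ solve 3 (λ a x N → a :* (x :- N :+ N) := (x :- con 0ℚ) :* a) refl (α ^ suc m) x (ℕ→ℚ n * β) ⟩
  (x - 0ℚ) * α ^ suc m ∎
  where
  n = suc (suc m)
  β = frac 1 (suc m)
  α = x - frac n (suc m)
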